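{- Let $\Gamma$ and $\Sigma$ be graphs, with $\Sigma$ having at least two vertices. If $(\Gamma,\Sigma)$ is stable, then $\mathrm{Aut}(\Gamma\times\Sigma)=P(\Gamma,\Sigma)$.
   Context: Graphs are finite and simple. The direct product $\Gamma\times\Sigma$ has vertex set $V(\Gamma)\times V(\Sigma)$, with $(u,x)\sim(v,y)$ iff $u\sim v$ in $\Gamma$ and $x\sim y$ in $\Sigma$. The pair $(\Gamma,\Sigma)$ is stable if $\mathrm{Aut}(\Gamma\times\Sigma)\cong\mathrm{Aut}(\Gamma)\times\mathrm{Aut}(\Sigma)$. $P(\Gamma,\Sigma)$ is the subgroup of elements of $\mathrm{Aut}(\Gamma\times\Sigma)$ that leave the partition $\{V(\Gamma)\times\{i\}: i\in V(\Sigma)\}$ invariant. -}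

module Defs where

open import Data.Nat using (ℕ)
open import Data.Fin using (Fin)
open import Data.Bool using (Bool; false; _∧_)
open import Data.Product using (_×_; _,_; proj₁; proj₂; ∃; ∃-syntax)
open import Relation.Binary.PropositionalEquality using (_≡_)

record Graph : Set where
  field
    n      : ℕ
    adj    : Fin n → Fin n → Bool
    sym    : ∀ u v → adj u v ≡ adj v u
    irrefl : ∀ v → adj v v ≡ false
open Graph public

record Auto (V : Set) (E : V → V → Bool) : Set where
  field
    fun     : V → V
    inv     : V → V
    fun-inv : ∀ v → fun (inv v) ≡ v
    inv-fun : ∀ v → inv (fun v) ≡ v
    pres    : ∀ u v → E (fun u) (fun v) ≡ E u v
open Auto public

_≈A_ : {V : Set} {E : V → V → Bool} → Auto V E → Auto V E → Set
a ≈A b = ∀ v → fun a v ≡ fun b v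

_∘A_ : {V : Set} {E : V → V → Bool} → Auto V E → Auto V E → Auto V E
_∘A_ {V} {E} a b = record
  { fun = λ v → fun a (fun b v)
  ; inv = λ v → inv b (inv a v)
  ; fun-inv = fi
  ; inv-fun = if
  ; pres = pr }
  where
  open import Relation.Binary.PropositionalEquality using (trans; cong)
  fi : ∀ v → fun a (fun b (inv b (inv a v))) ≡ v
  fi v = trans (cong (fun a) (fun-inv b (inv a v))) (fun-inv a v)
  if : ∀ v → inv b (inv a (fun a (fun b v))) ≡ v
  if v = trans (cong (inv b) (inv-fun a (fun b v))) (inv-fun b v)
  pr : ∀ u v → E (fun a (fun b u)) (fun a (fun b v)) ≡ E u v
  pr u v = trans (pres a (fun b u) (fun b v)) (pres b u v)

Aut : Graph → Set
Aut Γ = Auto (Fin (n Γ)) (adj Γ)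

prodAdj : (Γ Σ' : Graph) → (Fin (n Γ) × Fin (n Σ')) → (Fin (n Γ) × Fin (n Σ')) → Bool
prodAdj Γ Σ' (u , x) (v , y) = adj Γ u v ∧ adj Σ' x y

AutProd : Graph → Graph → Set
AutProd Γ Σ' = Auto (Fin (n Γ) × Fin (n Σ')) (prodAdj Γ Σ')

-- abstract group isomorphism Aut(Γ × Σ) ≅ Aut(Γ) × Aut(Σ)
-- (the right-hand side is the direct product of groups, with
--  componentwise composition and equality)
record GroupIso (Γ Σ' : Graph) : Set where
  field
    to       : AutProd Γ Σ' → Aut Γ × Aut Σ'
    from     : Aut Γ × Aut Σ' → AutProd Γ Σ'
    to-cong  : ∀ a b → a ≈A b → (proj₁ (to a) ≈A proj₁ (to b)) × (proj₂ (to a) ≈A proj₂ (to b))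
    from-cong : ∀ p q → (proj₁ p ≈A proj₁ q) → (proj₂ p ≈A proj₂ q) → from p ≈A from q
    to-from  : ∀ p → (proj₁ (to (from p)) ≈A proj₁ p) × (proj₂ (to (from p)) ≈A proj₂ p)
    from-to  : ∀ a → from (to a) ≈A a
    hom      : ∀ a b → (proj₁ (to (a ∘A b)) ≈A (proj₁ (to a) ∘A proj₁ (to b)))
                     × (proj₂ (to (a ∘A b)) ≈A (proj₂ (to a) ∘A proj₂ (to b)))

Stable : Graph → Graph → Set
Stable Γ Σ' = GroupIso Γ Σ'

-- φ leaves the partition { V(Γ) × {i} : i ∈ V(Σ) } invariant:
-- each block is mapped onto a block.
LeavesPartitionInvariant : (Γ Σ' : Graph) → AutProd Γ Σ' → Set
LeavesPartitionInvariant Γ Σ' φ =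
  ∀ (i : Fin (n Σ')) → ∃[ j ]
    ((∀ u → proj₂ (fun φ (u , i)) ≡ j)
     × (∀ v → ∃[ u ] fun φ (u , i) ≡ (v , j)))

InP : (Γ Σ' : Graph) → AutProd Γ Σ' → Set
InP = LeavesPartitionInvariant

-- Stability yields a map φ ↦ α ⊗ β from Aut(Γ × Σ) to itself, where (α , β) is the
-- image of φ under the isomorphism; it is injective, and its values are product
-- automorphisms, which preserve the partition into the layers V(Γ) × {i}.
-- Aut(Γ × Σ) is finite, so every φ is periodic under this injection and is
-- therefore itself one of its values.
module Submission where

open import Data.Bool using (_∧_)
import Data.Fin as Fin
open import Data.Fin using (Fin; toℕ; fromℕ<; combine; remQuot; funToFin; finToFun)
open import Data.Fin.Properties using (¬Fin0; pigeonhole; remQuot-combine; finToFun-funToFin)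
open import Data.Nat using (zero; suc; _+_; _*_; _^_; _≤_; s≤s; z≤n)
open import Data.Nat.GeneralisedArithmetic using (fold)
open import Data.Nat.Properties using (n<1+n; m≤n⇒∃[o]m+o≡n; +-suc; ≤-trans)
open import Data.Product using (_×_; _,_; proj₁; proj₂; ∃-syntax; uncurry)
open import Data.Sum using (_⊎_; inj₁; inj₂)
open import Data.Empty using (⊥-elim)
open import Function using (_∘_)
open import Relation.Nullary using (¬_)
open import Relation.Binary.PropositionalEquality
open import Defs hiding (sym)

Fin-empty⊎inhabited : ∀ k → ¬ Fin k ⊎ Fin k
Fin-empty⊎inhabited zero    = inj₁ ¬Fin0
Fin-empty⊎inhabited (suc k) = inj₂ Fin.zero

module _ {A : Set} (_≈_ : A → A → Set) (h : A → A)
         (h-injective : ∀ {x y} → h x ≈ h y → x ≈ y) where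

  fold-cancel : ∀ x i d → fold x h i ≈ fold x h (i + d) → x ≈ fold x h d
  fold-cancel x zero    d e = e
  fold-cancel x (suc i) d e = fold-cancel x i d (h-injective e)

  injective⇒periodic : ∀ {m} (code : A → Fin m) →
                       (∀ {x y} → code x ≡ code y → x ≈ y) →
                       ∀ x → ∃[ d ] x ≈ fold x h (suc d)
  injective⇒periodic code code-injective x
    with i , j , i<j , codes≡ ← pigeonhole (n<1+n _) (λ k → code (fold x h (toℕ k)))
    with d , 1+i+d≡j ← m≤n⇒∃[o]m+o≡n i<j
    = d , fold-cancel x (toℕ i) (suc d) orbit-returns
    where
    orbit-returns : fold x h (toℕ i) ≈ fold x h (toℕ i + suc d)
    orbit-returns = subst (λ k → fold x h (toℕ i) ≈ fold x h k)
                          (sym (trans (+-suc (toℕ i) d) 1+i+d≡j))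
                          (code-injective codes≡)

encodeEndo : ∀ {a b} → (Fin a × Fin b → Fin a × Fin b) → Fin ((a * b) ^ (a * b))
encodeEndo {b = b} f = funToFin (uncurry combine ∘ f ∘ remQuot b)

encodeEndo-injective : ∀ {a b} {f g : Fin a × Fin b → Fin a × Fin b} →
                       encodeEndo f ≡ encodeEndo g → ∀ p → f p ≡ g p
encodeEndo-injective {b = b} {f} {g} e p = begin
  f p                    ≡⟨ cong f (decode-encode p) ⟨
  f p′                   ≡⟨ decode-encode (f p′) ⟨
  decode (encode (f p′)) ≡⟨ cong decode (tables≡ (encode p)) ⟩
  decode (encode (g p′)) ≡⟨ decode-encode (g p′) ⟩
  g p′                   ≡⟨ cong g (decode-encode p) ⟩
  g p                    ∎
  where
  open ≡-Reasoning
  encode = uncurry combine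
  decode = remQuot b
  decode-encode : ∀ q → decode (encode q) ≡ q
  decode-encode (u , x) = remQuot-combine u x
  p′ = decode (encode p)
  tables≡ : ∀ k → encode (f (decode k)) ≡ encode (g (decode k))
  tables≡ k = trans (sym (finToFun-funToFin _ k))
                    (trans (cong (λ c → finToFun c k) e) (finToFun-funToFin _ k))

module ProductAutomorphisms (Γ Σ' : Graph) where

  infix 21 _⊗_

  _⊗_ : Aut Γ → Aut Σ' → AutProd Γ Σ'
  α ⊗ β = record
    { fun     = λ (u , x) → fun α u , fun β x
    ; inv     = λ (u , x) → inv α u , inv β x
    ; fun-inv = λ (u , x) → cong₂ _,_ (fun-inv α u) (fun-inv β x)
    ; inv-fun = λ (u , x) → cong₂ _,_ (inv-fun α u) (inv-fun β x)
    ; pres    = λ (u , x) (v , y) → cong₂ _∧_ (pres α u v) (pres β x y)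
    }

  ⊗-injective : Fin (n Γ) → Fin (n Σ') → ∀ {α α′ β β′} →
                α ⊗ β ≈A α′ ⊗ β′ → α ≈A α′ × β ≈A β′
  ⊗-injective u₀ x₀ e = (λ u → cong proj₁ (e (u , x₀))) , (λ x → cong proj₂ (e (u₀ , x)))

  InP-⊗ : ∀ α β → InP Γ Σ' (α ⊗ β)
  InP-⊗ α β i = fun β i , (λ _ → refl) , (λ v → inv α v , cong (_, fun β i) (fun-inv α v))

  InP-resp-≈A : ∀ {φ ψ} → φ ≈A ψ → InP Γ Σ' ψ → InP Γ Σ' φ
  InP-resp-≈A φ≈ψ ψ∈P i with j , layer , onto ← ψ∈P i =
    j , (λ u → trans (cong proj₂ (φ≈ψ (u , i))) (layer u))
      , (λ v → let u , eq = onto v in u , trans (φ≈ψ (u , i)) eq)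

  InP-empty : ¬ Fin (n Γ) → ∀ φ → InP Γ Σ' φ
  InP-empty ¬u φ i = i , (⊥-elim ∘ ¬u) , (⊥-elim ∘ ¬u)

module _ {Γ Σ' : Graph} (S : Stable Γ Σ') where
  open GroupIso S
  open ProductAutomorphisms Γ Σ'

  embed : AutProd Γ Σ' → AutProd Γ Σ'
  embed φ = uncurry _⊗_ (to φ)

  embed-injective : Fin (n Γ) → Fin (n Σ') → ∀ {φ ψ} → embed φ ≈A embed ψ → φ ≈A ψ
  embed-injective u₀ x₀ {φ} {ψ} e v = begin
    fun φ v                ≡⟨ from-to φ v ⟨
    fun (from (to φ)) v    ≡⟨ from-cong (to φ) (to ψ) α≈ β≈ v ⟩
    fun (from (to ψ)) v    ≡⟨ from-to ψ v ⟩
    fun ψ v                ∎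
    where
    open ≡-Reasoning
    α≈β≈ = ⊗-injective u₀ x₀ {proj₁ (to φ)} {proj₁ (to ψ)} {proj₂ (to φ)} {proj₂ (to ψ)} e
    α≈ = proj₁ α≈β≈
    β≈ = proj₂ α≈β≈

  Stable⇒InP : Fin (n Γ) → Fin (n Σ') → ∀ φ → InP Γ Σ' φ
  Stable⇒InP u₀ x₀ φ
    with d , φ≈ ← injective⇒periodic (_≈A_ {E = prodAdj Γ Σ'}) embed (embed-injective u₀ x₀)
                    (encodeEndo ∘ fun) encodeEndo-injective φ
    = InP-resp-≈A {φ} {embed (fold φ embed d)} φ≈ (uncurry InP-⊗ (to (fold φ embed d)))

lemma2p5 : (Γ Σ' : Graph) → 2 ≤ n Σ' → Stable Γ Σ' →
    (φ : AutProd Γ Σ') → InP Γ Σ' φ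
lemma2p5 Γ Σ' 2≤nΣ S with Fin-empty⊎inhabited (n Γ)
... | inj₁ ¬u = ProductAutomorphisms.InP-empty Γ Σ' ¬u
... | inj₂ u₀ = Stable⇒InP S u₀ (fromℕ< (≤-trans (s≤s z≤n) 2≤nΣ))
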